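{- Let $n\ge3$, let $P=(A_0,\dots,A_N)$ be a monotone weakly separated path of $3$-subsets of $[n]$ from $\{1,2,3\}$ to $\{n-2,n-1,n\}$, and let $C_i=(A_i\setminus A_{i-1})\cup(A_{i-1}\setminus A_i)$ for $i\in[N]$. For $1\le j\le N-1$, write $C_j=\{a,b\}$ with $a<b$ and $C_{j+1}=\{c,d\}$ with $c<d$. Then exactly one of the following holds: (i) $a<b=c<d$; (ii) $c<d=a<b$; (iii) $a<c<b<d$; (iv) $c<a<d<b$; (v) $a<c<d<b$; (vi) $c<a<b<d$.
   Context: Two different $k$-subsets $I,J$ are weakly separated if $\max(I\setminus J)<\min(J\setminus I)$ or $\max(J\setminus I)<\min(I\setminus J)$. A monotone weakly separated path is a sequence $(A_0,\dots,A_N)$ of $k$-subsets, pairwise weakly separated, such that for each $i$, $A_i\setminus A_{i-1}=\{x_i\}$ and $A_{i-1}\setminus A_i=\{y_i\}$ with $x_i>y_i$. -}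

module Defs where

open import Data.Nat using (ℕ; zero; suc; _∸_; _≤_) renaming (_<_ to _<ℕ_; _<ᵇ_ to _<ᵇℕ_; _≤ᵇ_ to _≤ᵇℕ_)
open import Data.Fin using (Fin; toℕ; _<_)
open import Data.Fin.Subset using (Subset; _∈_; _─_; _∪_; ⁅_⁆; ∣_∣)
open import Data.Vec using (tabulate)
open import Data.Product using (Σ; ∃; ∃-syntax; _×_)
open import Data.Sum using (_⊎_)
open import Data.List using (List; []; _∷_)
open import Data.List.Relation.Unary.All using (All)
open import Data.Empty using (⊥)
open import Level using (Lift)
import Level
open import Relation.Nullary using (¬_)
open import Relation.Binary.PropositionalEquality using (_≡_)

-- Ground set [n] is modelled by Fin n; the element i : Fin n stands for the
-- integer toℕ i + 1, so the order on Fin n is the order on [n].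

IsKSubset : ∀ {n} → ℕ → Subset n → Set
IsKSubset k I = ∣ I ∣ ≡ k

-- weak separation: max(I∖J) < min(J∖I) or max(J∖I) < min(I∖J),
-- written out as "every element of one difference is below every element of the other"
WeaklySeparated : ∀ {n} → Subset n → Subset n → Set
WeaklySeparated I J =
  (∀ x y → x ∈ (I ─ J) → y ∈ (J ─ I) → x < y) ⊎
  (∀ x y → x ∈ (J ─ I) → y ∈ (I ─ J) → x < y)

MonotoneStep : ∀ {n} → Subset n → Subset n → Set
MonotoneStep {n} B A = Σ (Fin n) λ x → Σ (Fin n) λ y →
  (A ─ B ≡ ⁅ x ⁆) × (B ─ A ≡ ⁅ y ⁆) × (y < x)

-- A monotone weakly separated path (A_0, …, A_N) of k-subsets of [n];
-- the path is given as A : ℕ → Subset n, only the values A 0 … A N matter.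
record MonotoneWSPath (n k N : ℕ) (A : ℕ → Subset n) : Set where
  field
    ksubset   : ∀ i → i ≤ N → IsKSubset k (A i)
    pairwiseWS : ∀ i j → i ≤ N → j ≤ N → WeaklySeparated (A i) (A j)
    monotone  : ∀ i → 1 ≤ i → i ≤ N → MonotoneStep (A (i ∸ 1)) (A i)

-- {1,2,3} ⊆ [n]  (indices 0,1,2)
first3 : (n : ℕ) → Subset n
first3 n = tabulate λ i → toℕ i <ᵇℕ 3

-- {n-2,n-1,n} ⊆ [n]  (indices n-3,n-2,n-1)
last3 : (n : ℕ) → Subset n
last3 n = tabulate λ i → (n ∸ 3) ≤ᵇℕ toℕ i

C : ∀ {n} → (ℕ → Subset n) → ℕ → Subset n
C A i = (A i ─ A (i ∸ 1)) ∪ (A (i ∸ 1) ─ A i)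

None : List Set → Set₁
None Ps = All ¬_ Ps

ExactlyOne : List Set → Set₁
ExactlyOne [] = Lift (Level.suc Level.zero) ⊥
ExactlyOne (P ∷ Ps) = (Lift (Level.suc Level.zero) P × None Ps) ⊎ (Lift (Level.suc Level.zero) (¬ P) × ExactlyOne Ps)

-- Write a = y₁ < x₁ = b for the elements removed and added by the step
-- A_{j-1} → A_j, and c = y₂ < x₂ = d for the step A_j → A_{j+1}.  Since a ∉ A_j ∋ c
-- and b ∈ A_j ∌ d, we have a ≠ c and b ≠ d.  If moreover a ≠ d and b ≠ c, then
-- a, c ∈ A_{j-1} ∖ A_{j+1} and b, d ∈ A_{j+1} ∖ A_{j-1}, so weak separation of
-- A_{j-1} and A_{j+1} together with a < b forces a, c < b, d.  This excludes b < c
-- and d < a, and the remaining relative positions of a < b and c < d are exactly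
-- the six listed ones; the cases c < a are the cases a < c with the two steps swapped.
module Submission where

open import Defs
open import Data.Nat using (ℕ; suc; _≤_; _∸_; s≤s; z≤n)
open import Data.Nat.Properties using (≤-trans; m∸n≤m; n≤1+n)
open import Data.Fin using (Fin; _<_)
open import Data.Fin.Properties using (<-trans; <-irrefl; <-asym; <-cmp; <⇒≢)
open import Data.Fin.Subset using (Subset; _∪_; ⁅_⁆; _∈_; _∉_; _─_; inside; outside)
open import Data.Fin.Subset.Properties
  using (x∈⁅x⁆; x∈⁅y⁆⇒x≡y; x∈p∪q⁻; x∈p∪q⁺; x∈p∧x∉q⇒x∈p─q; p─q⊆p; _∈?_)
open import Data.Vec using (_∷_; there)
open import Data.Product using (_×_; _,_; proj₁; proj₂)
open import Data.Sum using (_⊎_; inj₁; inj₂)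
open import Data.Empty using (⊥-elim)
open import Data.List using (List; _∷_; [])
open import Data.List.Relation.Unary.All using ([]; _∷_)
open import Level using (lift)
open import Relation.Nullary using (¬_; yes; no)
open import Relation.Binary.Definitions using (tri<; tri≈; tri>)
open import Relation.Binary.PropositionalEquality using (_≡_; _≢_; refl; sym; trans; subst; cong₂; ≢-sym)

private
  variable
    m : ℕ

x∈p─q⇒x∉q : ∀ {x : Fin m} {p q : Subset m} → x ∈ p ─ q → x ∉ q
x∈p─q⇒x∉q {p = _ ∷ _} {inside ∷ _}  (there x∈p─q) (there x∈q) = x∈p─q⇒x∉q x∈p─q x∈q
x∈p─q⇒x∉q {p = _ ∷ _} {outside ∷ _} (there x∈p─q) (there x∈q) = x∈p─q⇒x∉q x∈p─q x∈q

module SingletonDifference {S T : Subset m} {x : Fin m} (S─T≡x : S ─ T ≡ ⁅ x ⁆) where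

  x∈S─T : x ∈ S ─ T
  x∈S─T = subst (x ∈_) (sym S─T≡x) (x∈⁅x⁆ x)

  member : x ∈ S
  member = p─q⊆p S T x∈S─T

  nonmember : x ∉ T
  nonmember = x∈p─q⇒x∉q {p = S} x∈S─T

  unique : ∀ {z} → z ∈ S → z ∉ T → z ≡ x
  unique z∈S z∉T = x∈⁅y⁆⇒x≡y x (subst (_ ∈_) S─T≡x (x∈p∧x∉q⇒x∈p─q z∈S z∉T))

  retained : ∀ {z} → z ∈ S → z ≢ x → z ∈ T
  retained {z} z∈S z≢x with z ∈? T
  ... | yes z∈T = z∈T
  ... | no  z∉T = ⊥-elim (z≢x (unique z∈S z∉T))

sortedPair-unique : ∀ {x y a b : Fin m} → y < x → a < b →
                    ⁅ x ⁆ ∪ ⁅ y ⁆ ≡ ⁅ a ⁆ ∪ ⁅ b ⁆ → a ≡ y × b ≡ x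
sortedPair-unique {x = x} {y} {a} {b} y<x a<b xy≡ab = sorted (∈xy (inj₁ (x∈⁅x⁆ a))) (∈xy (inj₂ (x∈⁅x⁆ b)))
  where
  ∈xy : ∀ {z} → z ∈ ⁅ a ⁆ ⊎ z ∈ ⁅ b ⁆ → z ≡ x ⊎ z ≡ y
  ∈xy z∈ab with x∈p∪q⁻ ⁅ x ⁆ ⁅ y ⁆ (subst (_ ∈_) (sym xy≡ab) (x∈p∪q⁺ z∈ab))
  ... | inj₁ z∈x = inj₁ (x∈⁅y⁆⇒x≡y x z∈x)
  ... | inj₂ z∈y = inj₂ (x∈⁅y⁆⇒x≡y y z∈y)

  sorted : a ≡ x ⊎ a ≡ y → b ≡ x ⊎ b ≡ y → a ≡ y × b ≡ x
  sorted (inj₂ refl) (inj₁ refl) = refl , refl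
  sorted (inj₁ refl) (inj₁ refl) = ⊥-elim (<-irrefl refl a<b)
  sorted (inj₂ refl) (inj₂ refl) = ⊥-elim (<-irrefl refl a<b)
  sorted (inj₁ refl) (inj₂ refl) = ⊥-elim (<-asym a<b y<x)

Exchange : Subset m → Subset m → Fin m → Fin m → Set
Exchange P Q a b = P ─ Q ≡ ⁅ a ⁆ × Q ─ P ≡ ⁅ b ⁆

monotoneStep⇒exchange : ∀ {P Q : Subset m} {a b} → MonotoneStep P Q → a < b →
                        (Q ─ P) ∪ (P ─ Q) ≡ ⁅ a ⁆ ∪ ⁅ b ⁆ → Exchange P Q a b
monotoneStep⇒exchange (x , y , Q─P≡x , P─Q≡y , y<x) a<b C≡ab
  with sortedPair-unique y<x a<b (trans (sym (cong₂ _∪_ Q─P≡x P─Q≡y)) C≡ab)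
... | refl , refl = P─Q≡y , Q─P≡x

module ConsecutiveExchanges {P Q R : Subset m} {a b c d : Fin m}
  (P→Q : Exchange P Q a b) (Q→R : Exchange Q R c d) (a<b : a < b) (c<d : c < d)
  (P~R : WeaklySeparated P R) where

  private
    module P─Q = SingletonDifference (proj₁ P→Q)
    module Q─P = SingletonDifference (proj₂ P→Q)
    module Q─R = SingletonDifference (proj₁ Q→R)
    module R─Q = SingletonDifference (proj₂ Q→R)

  a≢c : a ≢ c
  a≢c refl = P─Q.nonmember Q─R.member

  b≢d : b ≢ d
  b≢d refl = R─Q.nonmember Q─P.member

  private
    below : a ≢ d → b ≢ c → c < b × a < d
    below a≢d b≢c = separate P~R
      where
      a∈P─R : a ∈ P ─ R
      a∈P─R = x∈p∧x∉q⇒x∈p─q P─Q.member (λ a∈R → a≢d (R─Q.unique a∈R P─Q.nonmember))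
      c∈P─R : c ∈ P ─ R
      c∈P─R = x∈p∧x∉q⇒x∈p─q (Q─P.retained Q─R.member (≢-sym b≢c)) Q─R.nonmember
      b∈R─P : b ∈ R ─ P
      b∈R─P = x∈p∧x∉q⇒x∈p─q (Q─R.retained Q─P.member b≢c) Q─P.nonmember
      d∈R─P : d ∈ R ─ P
      d∈R─P = x∈p∧x∉q⇒x∈p─q R─Q.member (λ d∈P → a≢d (sym (P─Q.unique d∈P R─Q.nonmember)))

      separate : WeaklySeparated P R → c < b × a < d
      separate (inj₁ P─R<R─P) = P─R<R─P c b c∈P─R b∈R─P , P─R<R─P a d a∈P─R d∈R─P
      separate (inj₂ R─P<P─R) = ⊥-elim (<-asym a<b (R─P<P─R b a b∈R─P a∈P─R))

  b≮c : ¬ b < c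
  b≮c b<c = <-asym b<c (proj₁ (below (<⇒≢ (<-trans a<b (<-trans b<c c<d))) (<⇒≢ b<c)))

  d≮a : ¬ d < a
  d≮a d<a = <-asym d<a (proj₂ (below (≢-sym (<⇒≢ d<a)) (≢-sym (<⇒≢ (<-trans c<d (<-trans d<a a<b))))))

Configurations : Fin m → Fin m → Fin m → Fin m → List Set
Configurations a b c d =
  (a < b × b ≡ c × c < d) ∷
  (c < d × d ≡ a × a < b) ∷
  (a < c × c < b × b < d) ∷
  (c < a × a < d × d < b) ∷
  (a < c × c < d × d < b) ∷
  (c < a × a < b × b < d) ∷ []

exactlyOne-here : ∀ {P : Set} {Ps} → P → None Ps → ExactlyOne (P ∷ Ps)
exactlyOne-here p ¬ps = inj₁ (lift p , ¬ps)

exactlyOne-there : ∀ {P : Set} {Ps} → ¬ P → ExactlyOne Ps → ExactlyOne (P ∷ Ps)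
exactlyOne-there ¬p one = inj₂ (lift ¬p , one)

swapAdjacent : List Set → List Set
swapAdjacent (P ∷ Q ∷ Ps) = Q ∷ P ∷ swapAdjacent Ps
swapAdjacent Ps           = Ps

none-swapAdjacent : ∀ {Ps} → None Ps → None (swapAdjacent Ps)
none-swapAdjacent []              = []
none-swapAdjacent (¬p ∷ [])       = ¬p ∷ []
none-swapAdjacent (¬p ∷ ¬q ∷ ¬ps) = ¬q ∷ ¬p ∷ none-swapAdjacent ¬ps

exactlyOne-swapAdjacent : ∀ {Ps} → ExactlyOne Ps → ExactlyOne (swapAdjacent Ps)
exactlyOne-swapAdjacent {[]}        one = one
exactlyOne-swapAdjacent {_ ∷ []}    one = one
exactlyOne-swapAdjacent {_ ∷ _ ∷ _} (inj₁ (lift p , ¬q ∷ ¬ps)) =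
  exactlyOne-there ¬q (exactlyOne-here p (none-swapAdjacent ¬ps))
exactlyOne-swapAdjacent {_ ∷ _ ∷ _} (inj₂ (lift ¬p , inj₁ (lift q , ¬ps))) =
  exactlyOne-here q (¬p ∷ none-swapAdjacent ¬ps)
exactlyOne-swapAdjacent {_ ∷ _ ∷ _} (inj₂ (lift ¬p , inj₂ (lift ¬q , one))) =
  exactlyOne-there ¬q (exactlyOne-there ¬p (exactlyOne-swapAdjacent one))

configurations-when-a<c : ∀ {a b c d : Fin m} → a < b → c < d → a < c → b ≢ d → ¬ b < c →
                          ExactlyOne (Configurations a b c d)
configurations-when-a<c {b = b} {c} {d} a<b c<d a<c b≢d b≮c with <-cmp b c
... | tri< b<c _ _ = ⊥-elim (b≮c b<c)
... | tri≈ _ refl _ = exactlyOne-here (a<b , refl , c<d)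
  ((λ { (_ , refl , _) → <-asym a<c c<d }) ∷
   (λ { (_ , c<b , _) → <-irrefl refl c<b }) ∷
   (λ { (c<a , _ , _) → <-asym a<c c<a }) ∷
   (λ { (_ , _ , d<b) → <-asym c<d d<b }) ∷
   (λ { (c<a , _ , _) → <-asym a<c c<a }) ∷ [])
... | tri> _ _ c<b with <-cmp b d
...   | tri≈ _ b≡d _ = ⊥-elim (b≢d b≡d)
...   | tri< b<d _ _ =
  exactlyOne-there (λ { (_ , refl , _) → <-irrefl refl c<b }) (
  exactlyOne-there (λ { (_ , refl , _) → <-asym a<c c<d }) (
  exactlyOne-here (a<c , c<b , b<d)
    ((λ { (c<a , _ , _) → <-asym a<c c<a }) ∷
     (λ { (_ , _ , d<b) → <-asym b<d d<b }) ∷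
     (λ { (c<a , _ , _) → <-asym a<c c<a }) ∷ [])))
...   | tri> _ _ d<b =
  exactlyOne-there (λ { (_ , refl , _) → <-irrefl refl c<b }) (
  exactlyOne-there (λ { (_ , refl , _) → <-asym a<c c<d }) (
  exactlyOne-there (λ { (_ , _ , b<d) → <-asym b<d d<b }) (
  exactlyOne-there (λ { (c<a , _ , _) → <-asym a<c c<a }) (
  exactlyOne-here (a<c , c<d , d<b)
    ((λ { (c<a , _ , _) → <-asym a<c c<a }) ∷ [])))))

configurations : ∀ {a b c d : Fin m} → a < b → c < d → a ≢ c → b ≢ d → ¬ b < c → ¬ d < a →
                 ExactlyOne (Configurations a b c d)
configurations a<b c<d a≢c b≢d b≮c d≮a with <-cmp _ _
... | tri< a<c _ _ = configurations-when-a<c a<b c<d a<c b≢d b≮c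
... | tri≈ _ a≡c _ = ⊥-elim (a≢c a≡c)
... | tri> _ _ c<a = exactlyOne-swapAdjacent (configurations-when-a<c c<d a<b c<a (≢-sym b≢d) d≮a)

lemma3p15 : (n : ℕ) → 3 ≤ n → (N : ℕ) → (A : ℕ → Subset n) →
    MonotoneWSPath n 3 N A → A 0 ≡ first3 n → A N ≡ last3 n →
    (j : ℕ) → 1 ≤ j → suc j ≤ N →
    (a b c d : Fin n) → a < b → C A j ≡ ⁅ a ⁆ ∪ ⁅ b ⁆ →
    c < d → C A (suc j) ≡ ⁅ c ⁆ ∪ ⁅ d ⁆ →
    ExactlyOne
      ((a < b × b ≡ c × c < d) ∷
       (c < d × d ≡ a × a < b) ∷
       (a < c × c < b × b < d) ∷
       (c < a × a < d × d < b) ∷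
       (a < c × c < d × d < b) ∷
       (c < a × a < b × b < d) ∷ [])
lemma3p15 n _ N A path _ _ j 1≤j j<N a b c d a<b Cⱼ≡ab c<d Cⱼ₊₁≡cd =
  configurations a<b c<d a≢c b≢d b≮c d≮a
  where
  open MonotoneWSPath path

  j≤N : j ≤ N
  j≤N = ≤-trans (n≤1+n j) j<N

  open ConsecutiveExchanges
    (monotoneStep⇒exchange (monotone j 1≤j j≤N) a<b Cⱼ≡ab)
    (monotoneStep⇒exchange (monotone (suc j) (s≤s z≤n) j<N) c<d Cⱼ₊₁≡cd)
    a<b c<d
    (pairwiseWS (j ∸ 1) (suc j) (≤-trans (m∸n≤m j 1) j≤N) j<N)
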